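{- For $n \ge 3$, $\gamma_t^d(C_n) = 2n/5$ if $n \equiv 0 \pmod 5$, and $\gamma_t^d(C_n) = \lceil 2(n+1)/5 \rceil$ otherwise.
   Context: $C_n$ is the cycle on $n$ vertices. For a graph $G$ with no isolated vertex, a set $S \subseteq V(G)$ is a disjunctive total dominating set if every vertex of $G$ either is adjacent to a vertex of $S$ or has at least two vertices of $S$ at distance exactly $2$ from it; $\gamma_t^d(G)$ is the minimum cardinality of such a set. -}

module Defs where

open import Data.Nat using (ℕ; zero; suc; _+_; _*_; _∸_; _≤_; _⊓_; _≡ᵇ_)
open import Data.Nat.DivMod using (_/_; _%_)
open import Data.Fin using (Fin; toℕ)
open import Data.Fin.Subset using (Subset; _∈_; ∣_∣)
open import Data.Bool using (Bool; true; false; if_then_else_; _∧_)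
open import Data.Vec using (Vec; lookup; tabulate; sum)
open import Data.List using (List; length; filter)
open import Data.Sum using (_⊎_)
open import Data.Product using (_×_; Σ; ∃; ∃-syntax)
open import Relation.Binary.PropositionalEquality using (_≡_)

absDiff : ℕ → ℕ → ℕ
absDiff a b = (a ∸ b) + (b ∸ a)

-- The cycle C_n on vertex set Fin n = {0,…,n-1}, with i ~ i+1 (mod n).
-- Graph distance in C_n (n ≥ 3): min(|i-j|, n - |i-j|).
cdist : (n : ℕ) → Fin n → Fin n → ℕ
cdist n i j = absDiff (toℕ i) (toℕ j) ⊓ (n ∸ absDiff (toℕ i) (toℕ j))

Adj : (n : ℕ) → Fin n → Fin n → Set
Adj n i j = cdist n i j ≡ 1

count2 : (n : ℕ) → Subset n → Fin n → ℕ
count2 n S v =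
  sum (tabulate (λ j → if lookup S j ∧ (cdist n v j ≡ᵇ 2) then 1 else 0))

IsDTDS : (n : ℕ) → Subset n → Set
IsDTDS n S = (v : Fin n) → (∃[ u ] (u ∈ S × Adj n v u)) ⊎ (2 ≤ count2 n S v)

IsDTDNumber : (n : ℕ) → ℕ → Set
IsDTDNumber n k =
  (Σ (Subset n) λ S → IsDTDS n S × ∣ S ∣ ≡ k)
  × ((S : Subset n) → IsDTDS n S → k ≤ ∣ S ∣)

module Submission where

-- Read a set S of vertices as the cyclic 0/1 sequence x of its membership; a gap
-- is a maximal run of non-members.  For n ≥ 5 the defining condition at a vertex v
-- only looks at the five vertices around it:  x(v-1) ∨ x(v+1) ∨ (x(v-2) ∧ x(v+2)).
-- In particular gaps have length at most 3, and a gap of length ≥ 2 is flanked by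
-- pairs of adjacent S-vertices.  Counting every vertex by the last S-vertex up to
-- it, and every S-vertex by the gap after it, gives the identity
--   5|S| = 2n + 3u + g₁ + 2g₂,
-- where g₁, g₂ count gaps of length 1 and 2 and u counts adjacent S-pairs followed
-- (equivalently, preceded) by a gap of length at most 1.  So 5|S| ≥ 2n; and
-- 5|S| = 2n + 1, the only way to beat the bound when n ≡ 2 (mod 5), would force
-- u = 0 and a single gap of length 1, which is impossible since such a gap is then
-- followed by a second one.  Conversely the first n terms of 1 1 0 0 0 1 1 0 0 0 …
-- form a disjunctive total dominating set meeting these bounds.  For C₃ and C₄ two
-- vertices suffice, and no cycle admits a smaller such set.

open import Defs
open import Data.Nat
open import Data.Nat.Properties
open import Data.Nat.DivMod
open import Data.Nat.Divisibility using (n∣m*n)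
open import Data.Nat.Tactic.RingSolver using (solve-∀)
open import Data.Bool using (Bool; true; false; T; not; if_then_else_; _∧_; _∨_)
open import Data.Unit using (tt)
open import Data.Empty using (⊥-elim)
open import Data.Fin using (Fin; toℕ; fromℕ<) renaming (zero to fzero; suc to fsuc)
open import Data.Fin.Properties using (toℕ-fromℕ<; toℕ-injective; toℕ<n)
open import Data.Fin.Subset using (Subset; _∈_; ∣_∣)
open import Data.Fin.Subset.Properties using (∣p∣≤∣x∷p∣)
open import Data.Vec using ([]; _∷_; here; there; lookup; tabulate; sum)
open import Data.Vec.Properties using ([]=⇒lookup; lookup⇒[]=; lookup∘tabulate)
open import Data.Sum using (_⊎_; inj₁; inj₂)
open import Data.Product using (∃; ∃-syntax; _×_; _,_; proj₁; proj₂)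
open import Function using (_∘_)
open import Relation.Binary.PropositionalEquality
open import Relation.Nullary using (yes; no; ¬_)

∑< : ℕ → (ℕ → ℕ) → ℕ
∑< zero    f = 0
∑< (suc m) f = f 0 + ∑< m (λ i → f (suc i))

syntax ∑< m (λ i → e) = ∑[ i < m ] e

∑-cong : ∀ m {f g : ℕ → ℕ} → (∀ i → i < m → f i ≡ g i) → ∑< m f ≡ ∑< m g
∑-cong zero    eq = refl
∑-cong (suc m) eq = cong₂ _+_ (eq 0 z<s) (∑-cong m (λ i i<m → eq (suc i) (s<s i<m)))

∑-mono : ∀ m {f g : ℕ → ℕ} → (∀ i → i < m → f i ≤ g i) → ∑< m f ≤ ∑< m g
∑-mono zero    le = z≤n
∑-mono (suc m) le = +-mono-≤ (le 0 z<s) (∑-mono m (λ i i<m → le (suc i) (s<s i<m)))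

∑-+ : ∀ m (f g : ℕ → ℕ) → ∑[ i < m ] (f i + g i) ≡ ∑< m f + ∑< m g
∑-+ zero    f g = refl
∑-+ (suc m) f g = begin
  (f 0 + g 0) + ∑[ i < m ] (f (suc i) + g (suc i))
    ≡⟨ cong ((f 0 + g 0) +_) (∑-+ m (λ i → f (suc i)) (λ i → g (suc i))) ⟩
  (f 0 + g 0) + (F + G)  ≡⟨ +-shuffle (f 0) (g 0) F G ⟩
  (f 0 + F) + (g 0 + G)  ∎
  where
  open ≡-Reasoning
  F = ∑[ i < m ] f (suc i)
  G = ∑[ i < m ] g (suc i)
  +-shuffle : ∀ a b c d → (a + b) + (c + d) ≡ (a + c) + (b + d)
  +-shuffle = solve-∀

∑-const : ∀ m c → ∑[ i < m ] c ≡ m * c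
∑-const zero    c = refl
∑-const (suc m) c = cong (c +_) (∑-const m c)

∑-rotate : ∀ m (f : ℕ → ℕ) → ∑[ i < m ] f (suc i) + f 0 ≡ ∑< m f + f m
∑-rotate zero    f = refl
∑-rotate (suc m) f = begin
  (f 1 + ∑[ i < m ] f (2 + i)) + f 0       ≡⟨ +-reorder (f 1) _ (f 0) ⟩
  f 0 + (∑[ i < m ] f (2 + i) + f 1)       ≡⟨ cong (f 0 +_) (∑-rotate m (λ i → f (suc i))) ⟩
  f 0 + (∑[ i < m ] f (suc i) + f (suc m)) ≡⟨ +-assoc (f 0) _ _ ⟨
  (f 0 + ∑[ i < m ] f (suc i)) + f (suc m) ∎
  where
  open ≡-Reasoning
  +-reorder : ∀ a b c → (a + b) + c ≡ c + (b + a)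
  +-reorder = solve-∀

Periodic : ℕ → (ℕ → ℕ) → Set
Periodic n f = ∀ i → f (n + i) ≡ f i

-- over a full period, the sum of a periodic sequence does not depend on the starting point;
-- this is what makes counts "along the cycle" invariant under shifting a pattern
∑-shift : ∀ n {f} → Periodic n f → ∀ k → ∑[ i < n ] f (k + i) ≡ ∑< n f
∑-shift n     per zero    = refl
∑-shift n {f} per (suc k) = begin
  ∑[ i < n ] f (suc k + i)   ≡⟨ ∑-cong n (λ i _ → cong f (+-suc k i)) ⟨
  ∑[ i < n ] f (k + suc i)   ≡⟨ +-cancelʳ-≡ _ _ _ (begin
      ∑[ i < n ] f (k + suc i) + f (k + 0)  ≡⟨ ∑-rotate n (λ i → f (k + i)) ⟩
      ∑[ i < n ] f (k + i) + f (k + n)      ≡⟨ cong (∑[ i < n ] f (k + i) +_) (trans (cong f (+-comm k n)) (per k)) ⟩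
      ∑[ i < n ] f (k + i) + f k            ≡⟨ cong (∑[ i < n ] f (k + i) +_) (cong f (+-identityʳ k)) ⟨
      ∑[ i < n ] f (k + i) + f (k + 0)      ∎) ⟩
  ∑[ i < n ] f (k + i)       ≡⟨ ∑-shift n per k ⟩
  ∑< n f ∎
  where open ≡-Reasoning

∑-≥-two-terms : ∀ m (f : ℕ → ℕ) → 3 ≤ m → f 0 + f 2 ≤ ∑< m f
∑-≥-two-terms (suc (suc (suc m))) f (s≤s (s≤s (s≤s _))) =
  +-monoʳ-≤ (f 0) (≤-trans (m≤m+n (f 2) _) (m≤n+m _ (f 1)))

∑-witness : ∀ m (f : ℕ → ℕ) → 0 < ∑< m f → ∃ λ i → i < m × 0 < f i
∑-witness (suc m) f pos with f 0 in eq
... | suc _ = 0 , z<s , subst (0 <_) (sym eq) z<s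
... | zero with ∑-witness m (λ i → f (suc i)) pos
...   | i , i<m , fi>0 = suc i , s<s i<m , fi>0

∑-zero : ∀ m (f : ℕ → ℕ) → ∑< m f ≡ 0 → ∀ i → i < m → f i ≡ 0
∑-zero (suc m) f eq zero    _         = m+n≡0⇒m≡0 (f 0) eq
∑-zero (suc m) f eq (suc i) (s<s i<m) = ∑-zero m (λ i → f (suc i)) (m+n≡0⇒n≡0 (f 0) eq) i i<m

ι : Bool → ℕ
ι b = if b then 1 else 0

oneHot : ℕ → ℕ → ℕ → ℕ
oneHot a c i = if i ≡ᵇ a then c else 0

oneHot-self : ∀ a c → oneHot a c a ≡ c
oneHot-self zero    c = refl
oneHot-self (suc a) c = oneHot-self a c

∑-oneHot : ∀ m {a} c → a < m → ∑[ i < m ] oneHot a c i ≡ c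
∑-oneHot (suc m) {zero}  c _ = trans (cong (c +_) (trans (∑-const m 0) (*-zeroʳ m))) (+-identityʳ c)
∑-oneHot (suc m) {suc a} c (s<s a<m) = ∑-oneHot m c a<m

sum-tabulate : ∀ {m} (f : Fin m → ℕ) (g : ℕ → ℕ) →
               (∀ i (i<m : i < m) → g i ≡ f (fromℕ< i<m)) → sum (tabulate f) ≡ ∑< m g
sum-tabulate {zero}  f g eq = refl
sum-tabulate {suc m} f g eq =
  cong₂ _+_ (sym (eq 0 z<s)) (sum-tabulate (λ j → f (fsuc j)) (λ i → g (suc i)) (λ i i<m → eq (suc i) (s<s i<m)))

∣S∣≡sum : ∀ {m} (S : Subset m) → ∣ S ∣ ≡ sum (tabulate (λ j → ι (lookup S j)))
∣S∣≡sum []          = refl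
∣S∣≡sum (true ∷ S)  = cong suc (∣S∣≡sum S)
∣S∣≡sum (false ∷ S) = ∣S∣≡sum S

one-member : ∀ {m} (S : Subset m) {u} → u ∈ S → 1 ≤ ∣ S ∣
one-member (_ ∷ S) here        = s≤s z≤n
one-member (b ∷ S) (there u∈S) = ≤-trans (one-member S u∈S) (∣p∣≤∣x∷p∣ b S)

two-members : ∀ {m} (S : Subset m) {u w} → u ≢ w → u ∈ S → w ∈ S → 2 ≤ ∣ S ∣
two-members (_ ∷ S) {fzero}  {fzero}  u≢w _ _ = ⊥-elim (u≢w refl)
two-members (_ ∷ S) {fzero}  {fsuc w} _ here (there w∈S) = s≤s (one-member S w∈S)
two-members (_ ∷ S) {fsuc u} {fzero}  _ (there u∈S) here = s≤s (one-member S u∈S)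
two-members (b ∷ S) {fsuc u} {fsuc w} u≢w (there u∈S) (there w∈S) =
  ≤-trans (two-members S (u≢w ∘ cong fsuc) u∈S w∈S) (∣p∣≤∣x∷p∣ b S)

ringDist : ℕ → ℕ → ℕ → ℕ
ringDist n a b = absDiff a b ⊓ (n ∸ absDiff a b)

absDiff-+ : ∀ a d → absDiff a (a + d) ≡ d
absDiff-+ a d rewrite m≤n⇒m∸n≡0 (m≤m+n a d) | m+n∸m≡n a d = refl

ringDist-comm : ∀ n a b → ringDist n a b ≡ ringDist n b a
ringDist-comm n a b rewrite +-comm (a ∸ b) (b ∸ a) = refl

ringDist-+ : ∀ n a d → ringDist n a (a + d) ≡ d ⊓ (n ∸ d)
ringDist-+ n a d rewrite absDiff-+ a d = refl

ringDist-self : ∀ n a → ringDist n a a ≡ 0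
ringDist-self n a rewrite n∸n≡0 a = refl

module _ {n : ℕ} .{{_ : NonZero n}} where

  %-absorbˡ : ∀ m k → (m % n + k) % n ≡ (m + k) % n
  %-absorbˡ m k = begin
    (m % n + k) % n           ≡⟨ %-distribˡ-+ (m % n) k n ⟩
    (m % n % n + k % n) % n   ≡⟨ cong (λ z → (z + k % n) % n) (m%n%n≡m%n m n) ⟩
    (m % n + k % n) % n       ≡⟨ %-distribˡ-+ m k n ⟨
    (m + k) % n ∎
    where open ≡-Reasoning

  %-below : ∀ {m b} → b < n → m ≡ b → m % n ≡ b
  %-below b<n refl = m<n⇒m%n≡m b<n

  %-wrap : ∀ {m b} → b < n → m ≡ b + n → m % n ≡ b
  %-wrap {b = b} b<n refl = trans ([m+n]%n≡m%n b n) (m<n⇒m%n≡m b<n)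

  ringDist-step : ∀ {a k} → a < n → k ≤ n → ringDist n a ((a + k) % n) ≡ k ⊓ (n ∸ k)
  ringDist-step {a} {k} a<n k≤n with a + k <? n
  ... | yes a+k<n rewrite m<n⇒m%n≡m a+k<n = ringDist-+ n a k
  ... | no  a+k≮n = begin
      ringDist n a ((a + k) % n)           ≡⟨ cong (ringDist n a) (%-wrap c<n (sym c+n≡a+k)) ⟩
      ringDist n a c                       ≡⟨ ringDist-comm n a c ⟩
      ringDist n c a                       ≡⟨ cong (ringDist n c) a≡c+[n∸k] ⟩
      ringDist n c (c + (n ∸ k))           ≡⟨ ringDist-+ n c (n ∸ k) ⟩
      (n ∸ k) ⊓ (n ∸ (n ∸ k))              ≡⟨ cong ((n ∸ k) ⊓_) (m∸[m∸n]≡n k≤n) ⟩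
      (n ∸ k) ⊓ k                          ≡⟨ ⊓-comm (n ∸ k) k ⟩
      k ⊓ (n ∸ k) ∎
    where
    open ≡-Reasoning
    c : ℕ
    c = a + k ∸ n
    c+n≡a+k : c + n ≡ a + k
    c+n≡a+k = m∸n+n≡m (≮⇒≥ a+k≮n)
    c<n : c < n
    c<n = +-cancelʳ-< n c n (subst (_< n + n) (sym c+n≡a+k) (+-mono-<-≤ a<n k≤n))
    a≡c+[n∸k] : a ≡ c + (n ∸ k)
    a≡c+[n∸k] = +-cancelʳ-≡ k a (c + (n ∸ k)) (begin
      a + k              ≡⟨ c+n≡a+k ⟨
      c + n              ≡⟨ cong (c +_) (m∸n+n≡m k≤n) ⟨
      c + (n ∸ k + k)    ≡⟨ +-assoc c (n ∸ k) k ⟨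
      c + (n ∸ k) + k ∎)

  ⊓-cases : ∀ e {k} → e ⊓ (n ∸ e) ≡ k → e ≡ k ⊎ k ≡ n ∸ e
  ⊓-cases e {k} eq with ⊓-sel e (n ∸ e)
  ... | inj₁ m≡e   = inj₁ (trans (sym m≡e) eq)
  ... | inj₂ m≡n∸e = inj₂ (trans (sym eq) m≡n∸e)

  ringDist-classify : ∀ {a b k} → a < n → b < n → ringDist n a b ≡ k →
                      b ≡ (a + k) % n ⊎ b ≡ (a + (n ∸ k)) % n
  ringDist-classify {a} {b} {k} a<n b<n dist with ≤-total a b
  ... | inj₁ a≤b
    with ⊓-cases (b ∸ a) (trans (sym (ringDist-+ n a (b ∸ a)))
                         (trans (cong (ringDist n a) (m+[n∸m]≡n a≤b)) dist))
  ...   | inj₁ e≡k   = inj₁ (sym (%-below b<n (trans (cong (a +_) (sym e≡k)) (m+[n∸m]≡n a≤b))))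
  ...   | inj₂ k≡n∸e = inj₂ (sym (%-below b<n (trans (cong (a +_) n∸k≡e) (m+[n∸m]≡n a≤b))))
    where
    n∸k≡e : n ∸ k ≡ b ∸ a
    n∸k≡e = trans (cong (n ∸_) k≡n∸e) (m∸[m∸n]≡n (≤-trans (m∸n≤m b a) (<⇒≤ b<n)))
  ringDist-classify {a} {b} {k} a<n b<n dist | inj₂ b≤a
    with ⊓-cases (a ∸ b) (trans (sym (ringDist-+ n b (a ∸ b)))
                         (trans (cong (ringDist n b) (m+[n∸m]≡n b≤a)) (trans (ringDist-comm n b a) dist)))
  ... | inj₁ e≡k   = inj₂ (sym (%-wrap b<n (begin
          a + (n ∸ k)              ≡⟨ cong (_+ (n ∸ k)) (m+[n∸m]≡n b≤a) ⟨
          b + (a ∸ b) + (n ∸ k)    ≡⟨ +-assoc b (a ∸ b) (n ∸ k) ⟩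
          b + ((a ∸ b) + (n ∸ k))  ≡⟨ cong (λ e → b + (e + (n ∸ k))) e≡k ⟩
          b + (k + (n ∸ k))        ≡⟨ cong (b +_) (m+[n∸m]≡n k≤n) ⟩
          b + n ∎)))
    where
    open ≡-Reasoning
    k≤n : k ≤ n
    k≤n = subst (_≤ n) e≡k (≤-trans (m∸n≤m a b) (<⇒≤ a<n))
  ... | inj₂ k≡n∸e = inj₁ (sym (%-wrap b<n (begin
          a + k                          ≡⟨ cong (_+ k) (m+[n∸m]≡n b≤a) ⟨
          b + (a ∸ b) + k                ≡⟨ +-assoc b (a ∸ b) k ⟩
          b + ((a ∸ b) + k)              ≡⟨ cong (λ z → b + ((a ∸ b) + z)) k≡n∸e ⟩
          b + ((a ∸ b) + (n ∸ (a ∸ b)))  ≡⟨ cong (b +_) (m+[n∸m]≡n (≤-trans (m∸n≤m a b) (<⇒≤ a<n))) ⟩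
          b + n ∎)))
    where open ≡-Reasoning

-- The local condition at the middle vertex c of five consecutive vertices a b c d e:
-- a neighbour is in S, or both vertices at distance 2 are.
dominated : Bool → Bool → Bool → Bool → Bool → Bool
dominated a b c d e = b ∨ d ∨ (a ∧ e)

dominated-b : ∀ {a b c d e} → b ≡ true → T (dominated a b c d e)
dominated-b refl = tt

dominated-d : ∀ {a b c d e} → d ≡ true → T (dominated a b c d e)
dominated-d {b = true}  refl = tt
dominated-d {b = false} refl = tt

dominated-ae : ∀ {a b c d e} → a ≡ true → e ≡ true → T (dominated a b c d e)
dominated-ae {b = true}              refl refl = tt
dominated-ae {b = false} {d = true}  refl refl = tt
dominated-ae {b = false} {d = false} refl refl = tt

dominated-cases : ∀ a b c d e → T (dominated a b c d e) →
                  b ≡ true ⊎ d ≡ true ⊎ (a ≡ true × e ≡ true)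
dominated-cases a     true  c d     e    _ = inj₁ refl
dominated-cases a     false c true  e    _ = inj₂ (inj₁ refl)
dominated-cases true  false c false true _ = inj₂ (inj₂ (refl , refl))

dominated-≡ : ∀ {a a' b b' c c' d d' e e'} → a ≡ a' → b ≡ b' → c ≡ c' → d ≡ d' → e ≡ e' →
              dominated a b c d e ≡ dominated a' b' c' d' e'
dominated-≡ refl refl refl refl refl = refl

-- the local condition at position 2 + i of a 0/1 sequence x
Dominated : (ℕ → Bool) → ℕ → Set
Dominated x i = T (dominated (x i) (x (1 + i)) (x (2 + i)) (x (3 + i)) (x (4 + i)))

ι-both : ∀ a b → 2 ≤ ι a + ι b → a ≡ true × b ≡ true
ι-both true  true  _ = refl , refl
ι-both true  false (s≤s ())
ι-both false true  (s≤s ())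

ι-∧ : ∀ a b → ι (a ∧ b) ≤ ι a
ι-∧ true  true  = ≤-refl
ι-∧ true  false = z≤n
ι-∧ false _     = z≤n

module OnTheCycle {n : ℕ} .{{_ : NonZero n}} where

  bit : Subset n → ℕ → Bool
  bit S i = lookup S (i mod n)

  toℕ-mod : ∀ i → toℕ (i mod n) ≡ i % n
  toℕ-mod i = toℕ-fromℕ< (m%n<n i n)

  bit-cong : ∀ S {i j} → i % n ≡ j % n → bit S i ≡ bit S j
  bit-cong S eq = cong (lookup S) (toℕ-injective (trans (toℕ-mod _) (trans eq (sym (toℕ-mod _)))))

  bit-periodic : ∀ S i → bit S (n + i) ≡ bit S i
  bit-periodic S i = bit-cong S (trans (cong (_% n) (+-comm n i)) ([m+n]%n≡m%n i n))

  bit-below : ∀ S {i} (i<n : i < n) → bit S i ≡ lookup S (fromℕ< i<n)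
  bit-below S {i} i<n =
    cong (lookup S) (toℕ-injective (trans (toℕ-mod i) (trans (m<n⇒m%n≡m i<n) (sym (toℕ-fromℕ< i<n)))))

  bit-member : ∀ S {u m} → u ∈ S → toℕ u ≡ m % n → bit S m ≡ true
  bit-member S {u} u∈S eq =
    trans (cong (lookup S) (toℕ-injective (trans (toℕ-mod _) (sym eq)))) ([]=⇒lookup u∈S)

  ∣S∣≡∑bit : ∀ S → ∣ S ∣ ≡ ∑[ i < n ] ι (bit S i)
  ∣S∣≡∑bit S = trans (∣S∣≡sum S) (sum-tabulate _ _ (λ i i<n → cong ι (bit-below S i<n)))

  count2≡∑ : ∀ S v → count2 n S v ≡ ∑[ i < n ] ι (bit S i ∧ (ringDist n (toℕ v) (i % n) ≡ᵇ 2))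
  count2≡∑ S v = sum-tabulate _ _ λ i i<n →
    cong₂ (λ b m → ι (b ∧ (ringDist n (toℕ v) m ≡ᵇ 2))) (bit-below S i<n) (%-toℕ i<n)
    where
    %-toℕ : ∀ {i} (i<n : i < n) → i % n ≡ toℕ (fromℕ< i<n)
    %-toℕ i<n = trans (m<n⇒m%n≡m i<n) (sym (toℕ-fromℕ< i<n))

  count2≤∣S∣ : ∀ S v → count2 n S v ≤ ∣ S ∣
  count2≤∣S∣ S v = begin
    count2 n S v               ≡⟨ count2≡∑ S v ⟩
    ∑[ i < n ] ι (bit S i ∧ _) ≤⟨ ∑-mono n (λ i _ → ι-∧ (bit S i) _) ⟩
    ∑[ i < n ] ι (bit S i)     ≡⟨ ∣S∣≡∑bit S ⟨
    ∣ S ∣ ∎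
    where open ≤-Reasoning

  module AroundVertex (S : Subset n) (v : Fin n) where
    p : ℕ
    p = toℕ v

    p<n : p < n
    p<n = toℕ<n v

    right₂ left₂ : ℕ
    right₂ = (p + 2) % n
    left₂  = (p + (n ∸ 2)) % n

    term : ℕ → ℕ
    term i = ι (bit S i ∧ (ringDist n p (i % n) ≡ᵇ 2))

    count2-upper : count2 n S v ≤ ι (bit S (p + 2)) + ι (bit S (p + (n ∸ 2)))
    count2-upper = begin
      count2 n S v                                                 ≡⟨ count2≡∑ S v ⟩
      ∑[ i < n ] term i                                            ≤⟨ ∑-mono n term-bound ⟩
      ∑[ i < n ] (oneHot right₂ x i + oneHot left₂ y i)            ≡⟨ ∑-+ n _ _ ⟩
      ∑[ i < n ] oneHot right₂ x i + ∑[ i < n ] oneHot left₂ y i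
        ≡⟨ cong₂ _+_ (∑-oneHot n x (m%n<n _ n)) (∑-oneHot n y (m%n<n _ n)) ⟩
      x + y ∎
      where
      open ≤-Reasoning
      x y : ℕ
      x = ι (bit S (p + 2))
      y = ι (bit S (p + (n ∸ 2)))
      reduced : ∀ m → bit S (m % n) ≡ true → bit S m ≡ true
      reduced m eq = trans (bit-cong S (sym (m%n%n≡m%n m n))) eq
      term-bound : ∀ i → i < n → term i ≤ oneHot right₂ x i + oneHot left₂ y i
      term-bound i i<n with bit S i in inS | ringDist n p (i % n) ≡ᵇ 2 in atDistance2
      ... | false | _     = z≤n
      ... | true  | false = z≤n
      ... | true  | true
            with ringDist-classify {n} p<n i<n
                   (trans (cong (ringDist n p) (sym (m<n⇒m%n≡m i<n))) (≡ᵇ⇒≡ _ 2 (subst T (sym atDistance2) tt)))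
      ...   | inj₁ refl = ≤-trans (≤-reflexive (trans (cong ι (sym (reduced (p + 2) inS)))
                                                      (sym (oneHot-self right₂ x))))
                                  (m≤m+n _ _)
      ...   | inj₂ refl = ≤-trans (≤-reflexive (trans (cong ι (sym (reduced (p + (n ∸ 2)) inS)))
                                                      (sym (oneHot-self left₂ y))))
                                  (m≤n+m _ _)

    module _ (5≤n : 5 ≤ n) where
      private
        2≤n : 2 ≤ n
        2≤n = ≤-trans (s≤s (s≤s z≤n)) 5≤n
        k : ℕ
        k = n ∸ 2
        k+2≡n : k + 2 ≡ n
        k+2≡n = m∸n+n≡m 2≤n
        2≤k : 2 ≤ k
        2≤k = +-cancelʳ-≤ 2 2 k (subst (4 ≤_) (sym k+2≡n) (≤-trans (n≤1+n 4) 5≤n))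
        1≤n∸1 : 1 ≤ n ∸ 1
        1≤n∸1 = m<n⇒0<n∸m (≤-trans (s≤s (s≤s z≤n)) 5≤n)

      dist-right₂ : ringDist n p right₂ ≡ 2
      dist-right₂ = trans (ringDist-step p<n 2≤n) (m≤n⇒m⊓n≡m 2≤k)

      dist-left₂ : ringDist n p left₂ ≡ 2
      dist-left₂ = trans (ringDist-step p<n (m∸n≤m n 2))
                         (trans (cong (k ⊓_) (m∸[m∸n]≡n 2≤n)) (m≥n⇒m⊓n≡n 2≤k))

      -- on a cycle of length at least 5 the two vertices at distance 2 are distinct:
      -- they are 4 steps apart, and 4 ⊓ (n ∸ 4) > 0
      right₂≢left₂ : right₂ ≢ left₂
      right₂≢left₂ eq = <⇒≢ positive (sym (begin
          ringDist n left₂ ((left₂ + 4) % n) ≡⟨ cong (ringDist n left₂) (trans (sym right₂≡left₂+4) eq) ⟩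
          ringDist n left₂ left₂             ≡⟨ ringDist-self n left₂ ⟩
          0 ∎))
        where
        open ≡-Reasoning
        positive : 0 < ringDist n left₂ ((left₂ + 4) % n)
        positive = subst (0 <_) (sym (ringDist-step (m%n<n _ n) (≤-trans (n≤1+n 4) 5≤n)))
                         (⊓-glb z<s (m<n⇒0<n∸m 5≤n))
        right₂≡left₂+4 : right₂ ≡ (left₂ + 4) % n
        right₂≡left₂+4 = begin
          (p + 2) % n             ≡⟨ [m+n]%n≡m%n (p + 2) n ⟨
          (p + 2 + n) % n         ≡⟨ cong (λ z → (p + 2 + z) % n) k+2≡n ⟨
          (p + 2 + (k + 2)) % n   ≡⟨ cong (_% n) (shuffle p k) ⟩
          (p + k + 4) % n         ≡⟨ %-absorbˡ (p + k) 4 ⟨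
          (left₂ + 4) % n ∎
          where
          shuffle : ∀ p k → p + 2 + (k + 2) ≡ p + k + 4
          shuffle = solve-∀

      count2-lower : bit S (p + 2) ≡ true → bit S (p + (n ∸ 2)) ≡ true → 2 ≤ count2 n S v
      count2-lower inR inL = begin
        2                                                          ≡⟨ cong₂ _+_ (∑-oneHot n 1 (m%n<n _ n))
                                                                                (∑-oneHot n 1 (m%n<n _ n)) ⟨
        ∑[ i < n ] oneHot right₂ 1 i + ∑[ i < n ] oneHot left₂ 1 i ≡⟨ ∑-+ n _ _ ⟨
        ∑[ i < n ] (oneHot right₂ 1 i + oneHot left₂ 1 i)          ≤⟨ ∑-mono n bound ⟩
        ∑[ i < n ] term i                                          ≡⟨ count2≡∑ S v ⟨
        count2 n S v ∎
        where
        open ≤-Reasoning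
        counted : ∀ m → bit S m ≡ true → ringDist n p (m % n) ≡ 2 → term (m % n) ≡ 1
        counted m b d = cong₂ (λ x y → ι (x ∧ (y ≡ᵇ 2)))
                              (trans (bit-cong S (m%n%n≡m%n m n)) b)
                              (trans (cong (ringDist n p) (m%n%n≡m%n m n)) d)
        bound : ∀ i → i < n → oneHot right₂ 1 i + oneHot left₂ 1 i ≤ term i
        bound i _ with i ≡ᵇ right₂ in isRight | i ≡ᵇ left₂ in isLeft
        ... | true  | true  = ⊥-elim (right₂≢left₂ (trans (sym (≡ᵇ⇒≡ i _ (subst T (sym isRight) tt)))
                                                         (≡ᵇ⇒≡ i _ (subst T (sym isLeft) tt))))
        ... | true  | false = ≤-reflexive (sym (trans (cong term (≡ᵇ⇒≡ i _ (subst T (sym isRight) tt)))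
                                                      (counted (p + 2) inR dist-right₂)))
        ... | false | true  = ≤-reflexive (sym (trans (cong term (≡ᵇ⇒≡ i _ (subst T (sym isLeft) tt)))
                                                      (counted (p + (n ∸ 2)) inL dist-left₂)))
        ... | false | false = z≤n

      L₂ L₁ C R₁ R₂ : Bool
      L₂ = bit S (p + (n ∸ 2))
      L₁ = bit S (p + (n ∸ 1))
      C  = bit S p
      R₁ = bit S (p + 1)
      R₂ = bit S (p + 2)

      around : Bool
      around = dominated L₂ L₁ C R₁ R₂

      neighbour : ∀ m → ringDist n p (m % n) ≡ 1 → Adj n v (m mod n)
      neighbour m d = trans (cong (ringDist n p) (toℕ-mod m)) d

      local-sound : (∃[ u ] (u ∈ S × Adj n v u)) ⊎ (2 ≤ count2 n S v) → T around
      local-sound (inj₁ (u , u∈S , adj)) with ringDist-classify p<n (toℕ<n u) adj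
      ... | inj₁ u≡right = dominated-d {L₂} {L₁} {C} {R₁} {R₂} (bit-member S u∈S u≡right)
      ... | inj₂ u≡left  = dominated-b {L₂} {L₁} {C} {R₁} {R₂} (bit-member S u∈S u≡left)
      local-sound (inj₂ c) with ι-both (bit S (p + 2)) (bit S (p + (n ∸ 2))) (≤-trans c count2-upper)
      ... | inR , inL = dominated-ae {L₂} {L₁} {C} {R₁} {R₂} inL inR

      local-complete : T around → (∃[ u ] (u ∈ S × Adj n v u)) ⊎ (2 ≤ count2 n S v)
      local-complete dom with dominated-cases L₂ L₁ C R₁ R₂ dom
      ... | inj₁ inL = inj₁ (_ , lookup⇒[]= _ S inL ,
              neighbour (p + (n ∸ 1)) (trans (ringDist-step p<n (m∸n≤m n 1))
                (trans (cong ((n ∸ 1) ⊓_) (m∸[m∸n]≡n (≤-trans (s≤s z≤n) 5≤n))) (m≥n⇒m⊓n≡n 1≤n∸1))))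
      ... | inj₂ (inj₁ inR) = inj₁ (_ , lookup⇒[]= _ S inR ,
              neighbour (p + 1) (trans (ringDist-step p<n (≤-trans (s≤s z≤n) 5≤n)) (m≤n⇒m⊓n≡m 1≤n∸1)))
      ... | inj₂ (inj₂ (inL , inR)) = inj₂ (count2-lower inR inL)

  module _ (5≤n : 5 ≤ n) (S : Subset n) where
    private
      2≤n : 2 ≤ n
      2≤n = ≤-trans (s≤s (s≤s z≤n)) 5≤n

      bit-+n : ∀ m → bit S (m + n) ≡ bit S m
      bit-+n m = bit-cong S ([m+n]%n≡m%n m n)

      wrap : ∀ k j → k ≤ n → k + j + (n ∸ k) ≡ j + n
      wrap k j k≤n = trans (reorder k j (n ∸ k)) (cong (j +_) (m+[n∸m]≡n k≤n))
        where
        reorder : ∀ k j m → k + j + m ≡ j + (k + m)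
        reorder = solve-∀

      offset : ∀ {i p} k → p ≡ (2 + i) % n → bit S (p + k) ≡ bit S (2 + i + k)
      offset {i} k refl = bit-cong S (%-absorbˡ (2 + i) k)

      window≡around : ∀ i (v : Fin n) → toℕ v ≡ (2 + i) % n →
                      dominated (bit S i) (bit S (1 + i)) (bit S (2 + i)) (bit S (3 + i)) (bit S (4 + i))
                      ≡ AroundVertex.around S v 5≤n
      window≡around i v eq = sym (dominated-≡
        (trans (offset (n ∸ 2) eq) (trans (cong (bit S) (wrap 2 i 2≤n)) (bit-+n i)))
        (trans (offset (n ∸ 1) eq) (trans (cong (bit S) (wrap 1 (1 + i) (≤-trans (s≤s z≤n) 2≤n))) (bit-+n (1 + i))))
        (trans (sym (cong (bit S) (+-identityʳ (toℕ v)))) (trans (offset 0 eq) (cong (bit S) (+-identityʳ (2 + i)))))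
        (trans (offset 1 eq) (cong (bit S) (+-comm (2 + i) 1)))
        (trans (offset 2 eq) (cong (bit S) (+-comm (2 + i) 2))))

    dtds⇒dominated : IsDTDS n S → ∀ i → Dominated (bit S) i
    dtds⇒dominated D i =
      subst T (sym (window≡around i v (toℕ-mod (2 + i)))) (AroundVertex.local-sound S v 5≤n (D v))
      where
      v : Fin n
      v = (2 + i) mod n

    dominated⇒dtds : (∀ i → Dominated (bit S) i) → IsDTDS n S
    dominated⇒dtds dom v =
      AroundVertex.local-complete S v 5≤n (subst T (window≡around i v centre) (dom i))
      where
      i : ℕ
      i = toℕ v + (n ∸ 2)
      centre : toℕ v ≡ (2 + i) % n
      centre = sym (trans (cong (_% n) (wrap 2 (toℕ v) 2≤n)) (trans ([m+n]%n≡m%n (toℕ v) n) (m<n⇒m%n≡m (toℕ<n v))))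

-- on any cycle a disjunctive total dominating set has at least two vertices: a vertex dominated
-- through a neighbour u forces a second member next to u, or two members at distance 2 from u
at-least-two : ∀ {m} (S : Subset (suc m)) → IsDTDS (suc m) S → 2 ≤ ∣ S ∣
at-least-two S D with D fzero
... | inj₂ two-at-distance-2 = ≤-trans two-at-distance-2 (OnTheCycle.count2≤∣S∣ S fzero)
... | inj₁ (u , u∈S , _) with D u
...   | inj₂ two-at-distance-2 = ≤-trans two-at-distance-2 (OnTheCycle.count2≤∣S∣ S u)
...   | inj₁ (w , w∈S , u~w) = two-members S u≢w u∈S w∈S
  where
  u≢w : u ≢ w
  u≢w refl = 0≢1+n (trans (sym (ringDist-self (suc _) (toℕ u))) u~w)

-- Local facts about dominated windows are finitely many and are checked by evaluation.
∀¹ : (Bool → Bool) → Bool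
∀¹ f = f true ∧ f false

∀¹-sound : ∀ f → T (∀¹ f) → ∀ a → T (f a)
∀¹-sound f ok true  = T-∧-left ok
  where T-∧-left : ∀ {x y} → T (x ∧ y) → T x
        T-∧-left {true} _ = tt
∀¹-sound f ok false = T-∧-right {f true} ok
  where T-∧-right : ∀ {x y} → T (x ∧ y) → T y
        T-∧-right {true} t = t

Pattern : Set
Pattern = Bool → Bool → Bool → Bool → Bool → Bool

∀⁵ : Pattern → Bool
∀⁵ P = ∀¹ λ a → ∀¹ λ b → ∀¹ λ c → ∀¹ λ d → ∀¹ λ e → P a b c d e

∀⁵-sound : ∀ P → T (∀⁵ P) → ∀ a b c d e → T (P a b c d e)
∀⁵-sound P ok a b c d e =
  ∀¹-sound (P a b c d) (
  ∀¹-sound (λ d → ∀¹ (P a b c d)) (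
  ∀¹-sound (λ c → ∀¹ λ d → ∀¹ (P a b c d)) (
  ∀¹-sound (λ b → ∀¹ λ c → ∀¹ λ d → ∀¹ (P a b c d)) (
  ∀¹-sound (λ a → ∀¹ λ b → ∀¹ λ c → ∀¹ λ d → ∀¹ (P a b c d)) ok a) b) c) d) e

OnDominated : Pattern → Set
OnDominated P = ∀ a b c d e → T (dominated a b c d e) → T (P a b c d e)

by-evaluation : ∀ P → T (∀⁵ λ a b c d e → not (dominated a b c d e) ∨ P a b c d e) → OnDominated P
by-evaluation P ok a b c d e dom =
  modus-ponens (∀⁵-sound (λ a b c d e → not (dominated a b c d e) ∨ P a b c d e) ok a b c d e) dom
  where
  modus-ponens : ∀ {x y} → T (not x ∨ y) → T x → T y
  modus-ponens {true} t _ = t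

⟨1⟩ ⟨11⟩ ⟨10⟩ ⟨100⟩ ⟨1000⟩ ⟨101⟩ ⟨1001⟩ ⟨001⟩ : Pattern
⟨1⟩    a _ _ _ _ = a
⟨11⟩   a b _ _ _ = a ∧ b
⟨10⟩   a b _ _ _ = a ∧ not b
⟨100⟩  a b c _ _ = a ∧ not b ∧ not c
⟨1000⟩ a b c d _ = a ∧ not b ∧ not c ∧ not d
⟨101⟩  a b c _ _ = a ∧ not b ∧ c
⟨1001⟩ a b c d _ = a ∧ not b ∧ not c ∧ d
⟨001⟩  a b c _ _ = not a ∧ not b ∧ c

⟨11⟩shortAfter : Pattern
⟨11⟩shortAfter _ b c d e = b ∧ c ∧ (d ∨ e)

⟨11⟩shortBefore : Pattern
⟨11⟩shortBefore a b c d _ = (a ∨ b) ∧ c ∧ d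

-- the last S-vertex up to position d lies 0, 1, 2 or 3 steps back: four non-members in a row
-- would leave the middle one undominated
last-member : OnDominated λ a b c d e →
  ι d + ι (c ∧ not d) + ι (b ∧ not c ∧ not d) + ι (a ∧ not b ∧ not c ∧ not d) ≡ᵇ 1
last-member = by-evaluation _ tt

member-split : OnDominated λ a b _ _ _ → ι a ≡ᵇ ι (a ∧ b) + ι (a ∧ not b)
member-split = by-evaluation _ tt

gap-split₁ : OnDominated λ a b c _ _ → ι (a ∧ not b) ≡ᵇ ι (a ∧ not b ∧ c) + ι (a ∧ not b ∧ not c)
gap-split₁ = by-evaluation _ tt

gap-split₂ : OnDominated λ a b c d _ →
  ι (a ∧ not b ∧ not c) ≡ᵇ ι (a ∧ not b ∧ not c ∧ d) + ι (a ∧ not b ∧ not c ∧ not d)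
gap-split₂ = by-evaluation _ tt

-- an S-vertex followed by a gap of length at least 2 has an S-neighbour on its other side
pair-after : OnDominated λ _ b c d e → ι (b ∧ c) ≡ᵇ ι (c ∧ not d ∧ not e) + ι (b ∧ c ∧ (d ∨ e))
pair-after = by-evaluation _ tt

-- an S-vertex preceded by a gap of length at least 2 has an S-neighbour on its other side
pair-before : OnDominated λ a b c d _ → ι (c ∧ d) ≡ᵇ ι (not a ∧ not b ∧ c) + ι ((a ∨ b) ∧ c ∧ d)
pair-before = by-evaluation _ tt

-- a gap of length at least 2 has length 2 or 3; counted by its first or by its last vertex,
-- the two counts differ by a telescoping term
long-gaps : OnDominated λ a b c d e →
  ι (a ∧ not b ∧ not c) + ι (b ∧ not c ∧ not d ∧ e) ≡ᵇ ι (not c ∧ not d ∧ e) + ι (a ∧ not b ∧ not c ∧ d)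
long-gaps = by-evaluation _ tt

gap₁-continues : OnDominated λ a b c d e → ι (a ∧ not b ∧ c) ≤ᵇ ι ((a ∨ b) ∧ c ∧ d) + ι (c ∧ not d ∧ e)
gap₁-continues = by-evaluation _ tt

excess-one : ∀ u g₁ g₂ → 3 * u + g₁ + 2 * g₂ ≡ 1 → u ≡ 0 × g₁ ≡ 1
excess-one zero    g₁ zero     eq = refl , trans (sym (+-identityʳ g₁)) eq
excess-one zero    g₁ (suc g₂) eq =
  ⊥-elim (<⇒≱ (s≤s (s≤s z≤n)) (subst (2 ≤_) eq
    (≤-trans (*-monoʳ-≤ 2 (s≤s z≤n)) (m≤n+m (2 * suc g₂) (3 * 0 + g₁)))))
excess-one (suc u) g₁ g₂       eq =
  ⊥-elim (<⇒≱ (s≤s (s≤s z≤n)) (subst (3 ≤_) eq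
    (≤-trans (*-monoʳ-≤ 3 (s≤s z≤n)) (≤-trans (m≤m+n (3 * suc u) g₁) (m≤m+n _ (2 * g₂))))))

module Counting (n : ℕ) (x : ℕ → Bool) (periodic : ∀ i → x (n + i) ≡ x i) (dom : ∀ i → Dominated x i) where

  at : Pattern → ℕ → ℕ
  at P i = ι (P (x i) (x (1 + i)) (x (2 + i)) (x (3 + i)) (x (4 + i)))

  at-periodic : ∀ P → Periodic n (at P)
  at-periodic P i = cong₅ (x-turn 0) (x-turn 1) (x-turn 2) (x-turn 3) (x-turn 4)
    where
    x-turn : ∀ k → x (k + (n + i)) ≡ x (k + i)
    x-turn k = trans (cong x (swap k n i)) (periodic (k + i))
      where
      swap : ∀ k n i → k + (n + i) ≡ n + (k + i)
      swap = solve-∀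
    cong₅ : ∀ {a a' b b' c c' d d' e e'} → a ≡ a' → b ≡ b' → c ≡ c' → d ≡ d' → e ≡ e' →
            ι (P a b c d e) ≡ ι (P a' b' c' d' e')
    cong₅ refl refl refl refl refl = refl

  # : Pattern → ℕ
  # P = ∑[ i < n ] at P i

  #-shift : ∀ P k → ∑[ i < n ] at P (k + i) ≡ # P
  #-shift P = ∑-shift n (at-periodic P)

  local : ∀ {P} → OnDominated P → ∀ i → T (P (x i) (x (1 + i)) (x (2 + i)) (x (3 + i)) (x (4 + i)))
  local fact i = fact (x i) (x (1 + i)) (x (2 + i)) (x (3 + i)) (x (4 + i)) (dom i)

  #-split : ∀ P Q R k l m → (∀ i → at P (k + i) ≡ at Q (l + i) + at R (m + i)) → # P ≡ # Q + # R
  #-split P Q R k l m eq = begin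
    # P                                               ≡⟨ #-shift P k ⟨
    ∑[ i < n ] at P (k + i)                           ≡⟨ ∑-cong n (λ i _ → eq i) ⟩
    ∑[ i < n ] (at Q (l + i) + at R (m + i))          ≡⟨ ∑-+ n _ _ ⟩
    ∑[ i < n ] at Q (l + i) + ∑[ i < n ] at R (m + i) ≡⟨ cong₂ _+_ (#-shift Q l) (#-shift R m) ⟩
    # Q + # R ∎
    where open ≡-Reasoning

  -- every vertex is counted once, by the last S-vertex up to it
  vertices : n ≡ # ⟨1⟩ + # ⟨10⟩ + # ⟨100⟩ + # ⟨1000⟩
  vertices = begin
    n                   ≡⟨ *-identityʳ n ⟨
    n * 1               ≡⟨ ∑-const n 1 ⟨
    ∑[ i < n ] 1        ≡⟨ ∑-cong n (λ i _ → sym (≡ᵇ⇒≡ _ _ (local last-member i))) ⟩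
    ∑[ i < n ] (at ⟨1⟩ (3 + i) + at ⟨10⟩ (2 + i) + at ⟨100⟩ (1 + i) + at ⟨1000⟩ i)
      ≡⟨ ∑-+ n _ _ ⟩
    ∑[ i < n ] (at ⟨1⟩ (3 + i) + at ⟨10⟩ (2 + i) + at ⟨100⟩ (1 + i)) + # ⟨1000⟩
      ≡⟨ cong (_+ # ⟨1000⟩) (∑-+ n _ _) ⟩
    ∑[ i < n ] (at ⟨1⟩ (3 + i) + at ⟨10⟩ (2 + i)) + ∑[ i < n ] at ⟨100⟩ (1 + i) + # ⟨1000⟩
      ≡⟨ cong (λ z → z + ∑[ i < n ] at ⟨100⟩ (1 + i) + # ⟨1000⟩) (∑-+ n _ _) ⟩
    ∑[ i < n ] at ⟨1⟩ (3 + i) + ∑[ i < n ] at ⟨10⟩ (2 + i) + ∑[ i < n ] at ⟨100⟩ (1 + i) + # ⟨1000⟩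
      ≡⟨ cong₂ (λ y z → y + z + # ⟨1000⟩) (cong₂ _+_ (#-shift ⟨1⟩ 3) (#-shift ⟨10⟩ 2)) (#-shift ⟨100⟩ 1) ⟩
    # ⟨1⟩ + # ⟨10⟩ + # ⟨100⟩ + # ⟨1000⟩ ∎
    where open ≡-Reasoning

  members : # ⟨1⟩ ≡ # ⟨11⟩ + # ⟨10⟩
  members = #-split ⟨1⟩ ⟨11⟩ ⟨10⟩ 0 0 0 (λ i → ≡ᵇ⇒≡ _ _ (local member-split i))

  gaps₁ : # ⟨10⟩ ≡ # ⟨101⟩ + # ⟨100⟩
  gaps₁ = #-split ⟨10⟩ ⟨101⟩ ⟨100⟩ 0 0 0 (λ i → ≡ᵇ⇒≡ _ _ (local gap-split₁ i))

  gaps₂ : # ⟨100⟩ ≡ # ⟨1001⟩ + # ⟨1000⟩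
  gaps₂ = #-split ⟨100⟩ ⟨1001⟩ ⟨1000⟩ 0 0 0 (λ i → ≡ᵇ⇒≡ _ _ (local gap-split₂ i))

  pairs-after : # ⟨11⟩ ≡ # ⟨100⟩ + # ⟨11⟩shortAfter
  pairs-after = #-split ⟨11⟩ ⟨100⟩ ⟨11⟩shortAfter 1 2 0 (λ i → ≡ᵇ⇒≡ _ _ (local pair-after i))

  pairs-before : # ⟨11⟩ ≡ # ⟨001⟩ + # ⟨11⟩shortBefore
  pairs-before = #-split ⟨11⟩ ⟨001⟩ ⟨11⟩shortBefore 2 0 0 (λ i → ≡ᵇ⇒≡ _ _ (local pair-before i))

  long-gaps-balance : # ⟨100⟩ ≡ # ⟨001⟩
  long-gaps-balance = +-cancelʳ-≡ (# ⟨1001⟩) _ _ (begin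
    # ⟨100⟩ + # ⟨1001⟩                           ≡⟨ cong (# ⟨100⟩ +_) (#-shift ⟨1001⟩ 1) ⟨
    # ⟨100⟩ + ∑[ i < n ] at ⟨1001⟩ (1 + i)       ≡⟨ ∑-+ n _ _ ⟨
    ∑[ i < n ] (at ⟨100⟩ i + at ⟨1001⟩ (1 + i))  ≡⟨ ∑-cong n (λ i _ → ≡ᵇ⇒≡ _ _ (local long-gaps i)) ⟩
    ∑[ i < n ] (at ⟨001⟩ (2 + i) + at ⟨1001⟩ i)  ≡⟨ ∑-+ n _ _ ⟩
    ∑[ i < n ] at ⟨001⟩ (2 + i) + # ⟨1001⟩       ≡⟨ cong (_+ # ⟨1001⟩) (#-shift ⟨001⟩ 2) ⟩
    # ⟨001⟩ + # ⟨1001⟩ ∎)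
    where open ≡-Reasoning

  short-pairs-balance : # ⟨11⟩shortAfter ≡ # ⟨11⟩shortBefore
  short-pairs-balance = +-cancelˡ-≡ (# ⟨100⟩) _ _ (begin
    # ⟨100⟩ + # ⟨11⟩shortAfter   ≡⟨ pairs-after ⟨
    # ⟨11⟩                       ≡⟨ pairs-before ⟩
    # ⟨001⟩ + # ⟨11⟩shortBefore  ≡⟨ cong (_+ # ⟨11⟩shortBefore) long-gaps-balance ⟨
    # ⟨100⟩ + # ⟨11⟩shortBefore  ∎)
    where open ≡-Reasoning

  excess : 5 * # ⟨1⟩ ≡ 2 * n + (3 * # ⟨11⟩shortAfter + # ⟨101⟩ + 2 * # ⟨1001⟩)
  excess = eliminate vertices members gaps₁ gaps₂ pairs-after
    where
    eliminate : ∀ {n s p l₁ l₂ l₃ g₁ g₂ u} →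
      n ≡ s + l₁ + l₂ + l₃ → s ≡ p + l₁ → l₁ ≡ g₁ + l₂ → l₂ ≡ g₂ + l₃ → p ≡ l₂ + u →
      5 * s ≡ 2 * n + (3 * u + g₁ + 2 * g₂)
    eliminate {g₁ = g₁} {g₂} {u} refl refl refl refl refl = identity g₁ g₂ _ u
      where
      identity : ∀ g₁ g₂ l₃ u → 5 * (g₂ + l₃ + u + (g₁ + (g₂ + l₃)))
        ≡ 2 * (g₂ + l₃ + u + (g₁ + (g₂ + l₃)) + (g₁ + (g₂ + l₃)) + (g₂ + l₃) + l₃) + (3 * u + g₁ + 2 * g₂)
      identity = solve-∀

  two-fifths : 2 * n ≤ 5 * # ⟨1⟩
  two-fifths = ≤-trans (m≤m+n (2 * n) _) (≤-reflexive (sym excess))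

  -- the excess 5|S| - 2n is never exactly 1: a lone gap of length 1 with no short pairs
  -- around would be followed by a second gap of length 1, two steps further
  excess≢1 : 3 ≤ n → 5 * # ⟨1⟩ ≢ 2 * n + 1
  excess≢1 3≤n eq
    with excess-one (# ⟨11⟩shortAfter) (# ⟨101⟩) (# ⟨1001⟩) (+-cancelˡ-≡ (2 * n) _ _ (trans (sym excess) eq))
  ... | noShortPairs , oneGap₁ with ∑-witness n (at ⟨101⟩) (subst (0 <_) (sym oneGap₁) z<s)
  ... | i , i<n , gapAt-i = <⇒≱ (s≤s (s≤s z≤n)) (begin
      2                                       ≤⟨ +-mono-≤ gapAt-i gapAt-2+i ⟩
      at ⟨101⟩ i + at ⟨101⟩ (2 + i)           ≡⟨ cong₂ _+_ (cong (at ⟨101⟩) (+-identityʳ i))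
                                                           (cong (at ⟨101⟩) (+-comm i 2)) ⟨
      at ⟨101⟩ (i + 0) + at ⟨101⟩ (i + 2)     ≤⟨ ∑-≥-two-terms n (λ j → at ⟨101⟩ (i + j)) 3≤n ⟩
      ∑[ j < n ] at ⟨101⟩ (i + j)             ≡⟨ #-shift ⟨101⟩ i ⟩
      # ⟨101⟩                                 ≡⟨ oneGap₁ ⟩
      1 ∎)
    where
    open ≤-Reasoning
    gapAt-2+i : 0 < at ⟨101⟩ (2 + i)
    gapAt-2+i = <-≤-trans gapAt-i (≤-trans (≤ᵇ⇒≤ _ _ (local gap₁-continues i))
                  (≤-reflexive (cong (_+ at ⟨101⟩ (2 + i))
                    (∑-zero n (at ⟨11⟩shortBefore) (trans (sym short-pairs-balance) noShortPairs) i i<n))))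

pattern₅ : ℕ → Bool
pattern₅ 0 = true
pattern₅ 1 = true
pattern₅ 2 = false
pattern₅ 3 = false
pattern₅ 4 = false
pattern₅ (suc (suc (suc (suc (suc i))))) = pattern₅ i

pattern₅-dominated : ∀ i → Dominated pattern₅ i
pattern₅-dominated 0 = tt
pattern₅-dominated 1 = tt
pattern₅-dominated 2 = tt
pattern₅-dominated 3 = tt
pattern₅-dominated 4 = tt
pattern₅-dominated (suc (suc (suc (suc (suc i))))) = pattern₅-dominated i

-- among the positions i, i + 1, i + 3 one is occupied; this is what is needed where the cycle closes up
pattern₅-closing : ∀ i → T (pattern₅ (1 + i) ∨ pattern₅ (3 + i) ∨ pattern₅ i)
pattern₅-closing 0 = tt
pattern₅-closing 1 = tt
pattern₅-closing 2 = tt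
pattern₅-closing 3 = tt
pattern₅-closing 4 = tt
pattern₅-closing (suc (suc (suc (suc (suc i))))) = pattern₅-closing i

-- the number of occupied positions among the first m; this is the value of γ_t^d(C_m)
size : ℕ → ℕ
size m = ∑[ i < m ] ι (pattern₅ i)

size-decomposition : ∀ q t → size (q * 5 + t) ≡ 2 * q + size t
size-decomposition zero    t = refl
size-decomposition (suc q) t = begin
  2 + size (q * 5 + t)     ≡⟨ cong (2 +_) (size-decomposition q t) ⟩
  2 + (2 * q + size t)     ≡⟨ +-assoc 2 (2 * q) (size t) ⟨
  2 + 2 * q + size t       ≡⟨ cong (_+ size t) (*-suc 2 q) ⟨
  2 * suc q + size t ∎
  where open ≡-Reasoning

periodicSet : ∀ n → Subset n
periodicSet n = tabulate (λ j → pattern₅ (toℕ j))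

module Construction {n : ℕ} .{{_ : NonZero n}} (5≤n : 5 ≤ n) where
  open OnTheCycle {n}

  private
    y : ℕ → Bool
    y = bit (periodicSet n)

    y≡ : ∀ i → y i ≡ pattern₅ (i % n)
    y≡ i = trans (lookup∘tabulate _ (i mod n)) (cong pattern₅ (toℕ-mod i))

    y-direct : ∀ {m} → m < n → y m ≡ pattern₅ m
    y-direct m<n = trans (y≡ _) (cong pattern₅ (m<n⇒m%n≡m m<n))

    y-wrap : ∀ {m} j → j < n → m ≡ j + n → y m ≡ pattern₅ j
    y-wrap j j<n eq = trans (y≡ _) (cong pattern₅ (%-wrap j<n eq))

    y-reduce : ∀ k i → y (k + i) ≡ y (k + i % n)
    y-reduce k i = bit-cong (periodicSet n) (begin
      (k + i) % n          ≡⟨ cong (_% n) (+-comm k i) ⟩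
      (i + k) % n          ≡⟨ %-absorbˡ i k ⟨
      (i % n + k) % n      ≡⟨ cong (_% n) (+-comm (i % n) k) ⟩
      (k + i % n) % n ∎)
      where open ≡-Reasoning

    1<n : 1 < n
    1<n = ≤-trans (s≤s (s≤s z≤n)) 5≤n

    wrapped : ∀ {m} j → j < 2 → m ≡ j + n → y m ≡ true
    wrapped 0 _ eq = y-wrap 0 (≤-trans (s≤s z≤n) 1<n) eq
    wrapped 1 _ eq = y-wrap 1 1<n eq
    wrapped (suc (suc _)) (s<s (s<s ())) _

    reaches : ∀ k r → k + r ≤ n → ¬ (k + r < n) → k + r ≡ n
    reaches _ _ ≤n ≮n = ≤-antisym ≤n (≮⇒≥ ≮n)

    dominated-closing : ∀ {a b c d e} → e ≡ true → T (b ∨ d ∨ a) → T (dominated a b c d e)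
    dominated-closing {b = true}                 refl _ = tt
    dominated-closing {b = false} {d = true}     refl _ = tt
    dominated-closing {true} {false} {d = false} refl _ = tt

    -- windows inside the first turn are windows of the infinite sequence; the four windows
    -- that cross the end of the turn see vertex 0 or 1 in the right place
    dominated-below : ∀ r → r < n → Dominated y r
    dominated-below r r<n with 4 + r <? n | 3 + r <? n | 2 + r <? n | 1 + r <? n
    ... | yes 4+r<n | _ | _ | _ =
      subst T (sym (dominated-≡ (y-direct r<n) (y-direct 1+r<n) (y-direct 2+r<n) (y-direct 3+r<n) (y-direct 4+r<n)))
        (pattern₅-dominated r)
      where
      3+r<n : 3 + r < n
      3+r<n = <-trans (n<1+n (3 + r)) 4+r<n
      2+r<n : 2 + r < n
      2+r<n = <-trans (n<1+n (2 + r)) 3+r<n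
      1+r<n : 1 + r < n
      1+r<n = <-trans (n<1+n (1 + r)) 2+r<n
    ... | no 4+r≮n | yes 3+r<n | _ | _ =
      dominated-closing {y r} {y (1 + r)} {y (2 + r)} {y (3 + r)} {y (4 + r)} (wrapped 0 z<s (reaches 4 r 3+r<n 4+r≮n))
        (subst T (closing-≡ (y-direct 1+r<n) (y-direct 3+r<n) (y-direct r<n)) (pattern₅-closing r))
      where
      2+r<n : 2 + r < n
      2+r<n = <-trans (n<1+n (2 + r)) 3+r<n
      1+r<n : 1 + r < n
      1+r<n = <-trans (n<1+n (1 + r)) 2+r<n
      closing-≡ : ∀ {a a' b b' c c'} → a' ≡ a → b' ≡ b → c' ≡ c → (a ∨ b ∨ c) ≡ (a' ∨ b' ∨ c')
      closing-≡ refl refl refl = refl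
    ... | no _ | no 3+r≮n | yes 2+r<n | _ =
      dominated-d {y r} {y (1 + r)} {y (2 + r)} {y (3 + r)} {y (4 + r)} (wrapped 0 z<s (reaches 3 r 2+r<n 3+r≮n))
    ... | no _ | no _ | no 2+r≮n | yes 1+r<n =
      dominated-d {y r} {y (1 + r)} {y (2 + r)} {y (3 + r)} {y (4 + r)}
        (wrapped 1 (s<s z<s) (cong suc (reaches 2 r 1+r<n 2+r≮n)))
    ... | no _ | no _ | no _ | no 1+r≮n =
      dominated-b {y r} {y (1 + r)} {y (2 + r)} {y (3 + r)} {y (4 + r)} (wrapped 0 z<s (reaches 1 r r<n 1+r≮n))

  periodicSet-dominated : ∀ i → Dominated (bit (periodicSet n)) i
  periodicSet-dominated i =
    subst T (sym (dominated-≡ (y-reduce 0 i) (y-reduce 1 i) (y-reduce 2 i) (y-reduce 3 i) (y-reduce 4 i)))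
      (dominated-below (i % n) (m%n<n i n))

  periodicSet-dtds : IsDTDS n (periodicSet n)
  periodicSet-dtds = dominated⇒dtds 5≤n (periodicSet n) periodicSet-dominated

  periodicSet-size : ∣ periodicSet n ∣ ≡ size n
  periodicSet-size = trans (∣S∣≡∑bit (periodicSet n)) (∑-cong n (λ i i<n → cong ι (y-direct i<n)))

by-residue : (P : ℕ → Set) → (∀ q t → t < 5 → P (q * 5 + t)) → ∀ n → P n
by-residue P case n = subst P (sym n≡q*5+t) (case (n / 5) (n % 5) (m%n<n n 5))
  where
  n≡q*5+t : n ≡ n / 5 * 5 + n % 5
  n≡q*5+t = trans (m≡m%n+[m/n]*n n 5) (+-comm (n % 5) _)

from-excess : ∀ a m s r → 5 * a ≡ 2 * m + r → r ≤ 4 → 2 * m ≤ 5 * s → a ≤ s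
from-excess a m s r eq r≤4 2m≤5s = s≤s⁻¹ (*-cancelˡ-< 5 a (suc s) (begin-strict
  5 * a         ≡⟨ eq ⟩
  2 * m + r     ≤⟨ +-mono-≤ 2m≤5s r≤4 ⟩
  5 * s + 4     <⟨ +-monoʳ-< (5 * s) (n<1+n 4) ⟩
  5 * s + 5     ≡⟨ +-comm (5 * s) 5 ⟩
  5 + 5 * s     ≡⟨ *-suc 5 s ⟨
  5 * suc s ∎))
  where open ≤-Reasoning

-- remainder 2: 2n = 10q + 4, so 5s ≥ 2n gives s > 2q, and s = 2q + 1 would make 5s = 2n + 1
remainder-two : ∀ q s → 2 * (q * 5 + 2) ≤ 5 * s → 5 * s ≢ 2 * (q * 5 + 2) + 1 → 2 * q + 2 ≤ s
remainder-two q s lower not-one with 2 * q + 2 ≤? s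
... | yes enough = enough
... | no  s≤2q+1 = ⊥-elim (not-one (begin
      5 * s               ≡⟨ cong (5 *_) (≤-antisym s≤2q+1′ 2q<s) ⟩
      5 * (2 * q + 1)     ≡⟨ identity q ⟩
      2 * (q * 5 + 2) + 1 ∎))
  where
  open ≡-Reasoning
  identity : ∀ q → 5 * (2 * q + 1) ≡ 2 * (q * 5 + 2) + 1
  identity = solve-∀
  identity′ : ∀ q → 5 * (2 * q) + 4 ≡ 2 * (q * 5 + 2)
  identity′ = solve-∀
  s≤2q+1′ : s ≤ 2 * q + 1
  s≤2q+1′ = s≤s⁻¹ (subst (suc s ≤_) (+-suc (2 * q) 1) (≰⇒> s≤2q+1))
  2q<s : 2 * q + 1 ≤ s
  2q<s = subst (_≤ s) (+-comm 1 (2 * q))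
               (*-cancelˡ-< 5 (2 * q) s (<-≤-trans (m<m+n (5 * (2 * q)) {4} z<s)
                                                   (≤-trans (≤-reflexive (identity′ q)) lower)))

size-minimal : ∀ n s → 2 * n ≤ 5 * s → 5 * s ≢ 2 * n + 1 → size n ≤ s
size-minimal = by-residue _ λ q t t<5 s lower not-one →
  subst (_≤ s) (sym (size-decomposition q t)) (by-remainder q s t t<5 lower not-one)
  where
  by-remainder : ∀ q s t → t < 5 → 2 * (q * 5 + t) ≤ 5 * s → 5 * s ≢ 2 * (q * 5 + t) + 1 → 2 * q + size t ≤ s
  by-remainder q s 0 _ lower _ = from-excess _ (q * 5 + 0) s 0 (identity q) z≤n lower
    where identity : ∀ q → 5 * (2 * q + 0) ≡ 2 * (q * 5 + 0) + 0
          identity = solve-∀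
  by-remainder q s 1 _ lower _ = from-excess _ (q * 5 + 1) s 3 (identity q) (n≤1+n 3) lower
    where identity : ∀ q → 5 * (2 * q + 1) ≡ 2 * (q * 5 + 1) + 3
          identity = solve-∀
  by-remainder q s 2 _ lower not-one = remainder-two q s lower not-one
  by-remainder q s 3 _ lower _ = from-excess _ (q * 5 + 3) s 4 (identity q) ≤-refl lower
    where identity : ∀ q → 5 * (2 * q + 2) ≡ 2 * (q * 5 + 3) + 4
          identity = solve-∀
  by-remainder q s 4 _ lower _ = from-excess _ (q * 5 + 4) s 2 (identity q) (s≤s (s≤s z≤n)) lower
    where identity : ∀ q → 5 * (2 * q + 2) ≡ 2 * (q * 5 + 4) + 2
          identity = solve-∀
  by-remainder q s (suc (suc (suc (suc (suc _))))) (s<s (s<s (s<s (s<s (s<s ()))))) _ _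

quotient : ∀ q t {m} r → m ≡ 2 * q * 5 + r → r / 5 ≡ size t → m / 5 ≡ size (q * 5 + t)
quotient q t r refl r/5 = begin
  (2 * q * 5 + r) / 5   ≡⟨ +-distrib-/-∣ˡ r (n∣m*n (2 * q)) ⟩
  2 * q * 5 / 5 + r / 5 ≡⟨ cong₂ _+_ (m*n/n≡m (2 * q) 5) r/5 ⟩
  2 * q + size t        ≡⟨ size-decomposition q t ⟨
  size (q * 5 + t) ∎
  where open ≡-Reasoning

closed-form : ∀ n → (n % 5 ≡ 0 → (2 * n) / 5 ≡ size n) × (n % 5 ≢ 0 → (2 * (n + 1) + 4) / 5 ≡ size n)
closed-form = by-residue _ λ q t t<5 →
  subst (λ r → (r ≡ 0 → (2 * (q * 5 + t)) / 5 ≡ size (q * 5 + t))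
             × (r ≢ 0 → (2 * (q * 5 + t + 1) + 4) / 5 ≡ size (q * 5 + t)))
        (sym (remainder q t t<5)) (by-remainder q t t<5)
  where
  remainder : ∀ q t → t < 5 → (q * 5 + t) % 5 ≡ t
  remainder q t t<5 = trans (cong (_% 5) (+-comm (q * 5) t)) (trans ([m+kn]%n≡m%n t q 5) (m<n⇒m%n≡m t<5))
  by-remainder : ∀ q t → t < 5 → (t ≡ 0 → (2 * (q * 5 + t)) / 5 ≡ size (q * 5 + t))
                                × (t ≢ 0 → (2 * (q * 5 + t + 1) + 4) / 5 ≡ size (q * 5 + t))
  by-remainder q 0 _ = (λ _ → quotient q 0 0 (identity q) refl) , λ 0≢0 → ⊥-elim (0≢0 refl)
    where identity : ∀ q → 2 * (q * 5 + 0) ≡ 2 * q * 5 + 0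
          identity = solve-∀
  by-remainder q 1 _ = (λ ()) , λ _ → quotient q 1 8 (identity q) refl
    where identity : ∀ q → 2 * (q * 5 + 1 + 1) + 4 ≡ 2 * q * 5 + 8
          identity = solve-∀
  by-remainder q 2 _ = (λ ()) , λ _ → quotient q 2 10 (identity q) refl
    where identity : ∀ q → 2 * (q * 5 + 2 + 1) + 4 ≡ 2 * q * 5 + 10
          identity = solve-∀
  by-remainder q 3 _ = (λ ()) , λ _ → quotient q 3 12 (identity q) refl
    where identity : ∀ q → 2 * (q * 5 + 3 + 1) + 4 ≡ 2 * q * 5 + 12
          identity = solve-∀
  by-remainder q 4 _ = (λ ()) , λ _ → quotient q 4 14 (identity q) refl
    where identity : ∀ q → 2 * (q * 5 + 4 + 1) + 4 ≡ 2 * q * 5 + 14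
          identity = solve-∀
  by-remainder q (suc (suc (suc (suc (suc _))))) (s<s (s<s (s<s (s<s (s<s ())))))

cycle-bound : ∀ {n} .{{_ : NonZero n}} → 5 ≤ n → ∀ S → IsDTDS n S →
              2 * n ≤ 5 * ∣ S ∣ × 5 * ∣ S ∣ ≢ 2 * n + 1
cycle-bound {n} 5≤n S D =
  subst (λ s → 2 * n ≤ 5 * s × 5 * s ≢ 2 * n + 1) (sym (∣S∣≡∑bit S))
        (two-fifths , excess≢1 (≤-trans (s≤s (s≤s (s≤s z≤n))) 5≤n))
  where
  open OnTheCycle {n}
  open Counting n (bit S) (bit-periodic S) (dtds⇒dominated 5≤n S D)

dtds₃ : IsDTDS 3 (periodicSet 3)
dtds₃ fzero               = inj₁ (fsuc fzero , there here , refl)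
dtds₃ (fsuc fzero)        = inj₁ (fzero , here , refl)
dtds₃ (fsuc (fsuc fzero)) = inj₁ (fzero , here , refl)

dtds₄ : IsDTDS 4 (periodicSet 4)
dtds₄ fzero                      = inj₁ (fsuc fzero , there here , refl)
dtds₄ (fsuc fzero)               = inj₁ (fzero , here , refl)
dtds₄ (fsuc (fsuc fzero))        = inj₁ (fsuc fzero , there here , refl)
dtds₄ (fsuc (fsuc (fsuc fzero))) = inj₁ (fzero , here , refl)

γ-cycle : ∀ n → 3 ≤ n → IsDTDNumber n (size n)
γ-cycle 1 (s≤s ())
γ-cycle 2 (s≤s (s≤s ()))
γ-cycle 3 _ = (periodicSet 3 , dtds₃ , refl) , at-least-two
γ-cycle 4 _ = (periodicSet 4 , dtds₄ , refl) , at-least-two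
γ-cycle n@(suc (suc (suc (suc (suc _))))) _ =
  (periodicSet n , periodicSet-dtds , periodicSet-size) ,
  λ S D → size-minimal n ∣ S ∣ (proj₁ (cycle-bound 5≤n S D)) (proj₂ (cycle-bound 5≤n S D))
  where
  5≤n : 5 ≤ n
  5≤n = s≤s (s≤s (s≤s (s≤s (s≤s z≤n))))
  open Construction 5≤n

propositionp : (n : ℕ) → 3 ≤ n →
    (n % 5 ≡ 0 → IsDTDNumber n ((2 * n) / 5))
    × (n % 5 ≢ 0 → IsDTDNumber n ((2 * (n + 1) + 4) / 5))
propositionp n 3≤n =
  (λ n%5≡0 → subst (IsDTDNumber n) (sym (proj₁ (closed-form n) n%5≡0)) (γ-cycle n 3≤n)) ,
  (λ n%5≢0 → subst (IsDTDNumber n) (sym (proj₂ (closed-form n) n%5≢0)) (γ-cycle n 3≤n))
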